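{- Let $G=(X,Y;E)$ be a bipartite permutation graph with bipartition into independent sets $X$ and $Y$. Then $G$ can be represented by a permutation diagram $(\mathtt{x}_1,\mathtt{x}_2)$ in which $\mathtt{x}_2(x)=\mathtt{x}_1(x)+1$ for all $x\in X$ and $\mathtt{x}_2(y)=\mathtt{x}_1(y)-1$ for all $y\in Y$.
   Context: A graph $G=(V,E)$ is a permutation graph if there exist linear orderings $\prec_1,\prec_2$ on $V$ such that for distinct $u,v$: $uv\in E$ iff ($u\prec_1 v$ and $v\prec_2 u$) or ($u\prec_2 v$ and $v\prec_1 u$); a bipartite permutation graph is a bipartite graph that is a permutation graph. A permutation diagram representing $G$ is a pair of injective functions $\mathtt{x}_1,\mathtt{x}_2\colon V\to\mathbb{R}$ (the positions of each vertex on two parallel horizontal lines $\ell_1,\ell_2$, joined by a segment) such that for all distinct $u,v\in V$: $uv\in E$ iff $(\mathtt{x}_1(u)-\mathtt{x}_1(v))(\mathtt{x}_2(u)-\mathtt{x}_2(v))<0$. -}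

module Defs where

open import Data.Nat using (ℕ)
open import Data.Fin using (Fin)
open import Data.Bool using (Bool; true; false)
open import Data.Product using (Σ; _×_; _,_)
open import Data.Sum using (_⊎_)
open import Relation.Nullary using (¬_)
open import Relation.Binary.PropositionalEquality using (_≡_; _≢_)
open import Relation.Binary.Structures using (IsStrictTotalOrder)
open import Function.Bundles using (_⇔_)
open import Function.Definitions using (Injective)
open import Data.Rational using (ℚ; _+_; _-_; _*_; _<_; 0ℚ; 1ℚ)

record Graph (n : ℕ) : Set₁ where
  field
    Adj    : Fin n → Fin n → Set
    sym    : ∀ {u v} → Adj u v → Adj v u
    irrefl : ∀ {u} → ¬ Adj u u
open Graph public

IsPermutationGraph : ∀ {n} → Graph n → Set₁
IsPermutationGraph {n} G =
  Σ (Fin n → Fin n → Set) λ R₁ → Σ (Fin n → Fin n → Set) λ R₂ →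
    IsStrictTotalOrder _≡_ R₁ × IsStrictTotalOrder _≡_ R₂ ×
    (∀ u v → u ≢ v →
      (Adj G u v ⇔ ((R₁ u v × R₂ v u) ⊎ (R₂ u v × R₁ v u))))

-- inX v = true means v ∈ X, false means v ∈ Y; X and Y are independent sets.
IsBipartition : ∀ {n} → Graph n → (Fin n → Bool) → Set
IsBipartition G inX = ∀ u v → Adj G u v → inX u ≢ inX v

IsPermutationDiagram : ∀ {n} → Graph n → (Fin n → ℚ) → (Fin n → ℚ) → Set
IsPermutationDiagram G x₁ x₂ =
  Injective _≡_ _≡_ x₁ × Injective _≡_ _≡_ x₂ ×
  (∀ u v → u ≢ v → (Adj G u v ⇔ ((x₁ u - x₁ v) * (x₂ u - x₂ v) < 0ℚ)))

-- Let <₁ and <₂ be the two orders, so that uv is an edge iff they disagree on u and v.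
-- As X and Y are independent, the orders agree on monochromatic pairs, so an edge xy
-- with x ∈ X, y ∈ Y is either forward (x <₁ y, y <₂ x) or backward (y <₁ x, x <₂ y),
-- and no vertex lies on edges of both kinds.  Hence the vertices on backward edges form
-- a union of components, and exchanging <₁ and <₂ on them makes every edge forward
-- without changing the graph.
-- For such orders x₁ is built along <₁, the last vertex v being placed at a position t
-- above all others: if v ∈ Y, t must be less than x₁ x + 2 exactly for its neighbours x;
-- if v ∈ X, t is taken below x₁ x + 2 for every X-vertex x that no Y-vertex follows on
-- line 2.  Both choices are possible thanks to the invariant that two X-vertices x, x′
-- are less than 2 apart unless some Y-vertex lies after x on line 2 and before x′ on line 1.

module Submission where

open import Defs using (Graph; Adj; IsBipartition; IsPermutationGraph; IsPermutationDiagram)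

open import Data.Bool using (Bool; true; false; not; _∧_; if_then_else_)
import Data.Bool as Bool
open import Data.Bool.Properties using (not-¬)
open import Data.Empty using (⊥-elim)
open import Data.Fin using (Fin; zero; suc; punchIn; punchOut)
open import Data.Fin.Properties using (punchIn-injective; punchIn-punchOut; punchInᵢ≢i; all?; any?)
open import Data.Nat using (ℕ; zero; suc)
open import Data.Product using (Σ; ∃; ∃-syntax; _×_; _,_; proj₁; proj₂)
open import Data.Product.Function.NonDependent.Propositional using (_×-⇔_)
open import Data.Rational using (ℚ; _+_; _-_; _*_; _<_; _≤_; -_; 0ℚ; 1ℚ; positive; negative)
open import Data.Rational.Properties
  using (<-cmp; <-irrefl; <-asym; <-trans; <-≤-trans; ≤-<-trans; <⇒≤; ≤-refl; ≤-reflexive; ≮⇒≥; <-dense;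
         <-isStrictTotalOrder; +-monoˡ-<; +-monoʳ-<; +-assoc; +-identityʳ; +-inverseʳ; *-zeroˡ; *-zeroʳ;
         neg-antimono-<; positive⁻¹; negative⁻¹; neg*pos⇒neg; pos*neg⇒neg; neg*neg⇒pos; pos*pos⇒pos)
open import Data.Sum using (_⊎_; inj₁; inj₂)
import Data.Sum as Sum
open import Data.Sum.Function.Propositional using (_⊎-⇔_)
open import Data.Unit using (tt)
open import Data.Vec.Functional using (insertAt)
open import Data.Vec.Functional.Properties using (insertAt-lookup; insertAt-punchIn)
open import Function using (_∘_; _on_; id)
open import Function.Bundles using (_⇔_; mk⇔; Equivalence)
open import Function.Construct.Symmetry using (⇔-sym)
open import Function.Construct.Composition using (_⇔-∘_)
open import Function.Definitions using (Injective)
open import Level using (Level; 0ℓ)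
open import Relation.Binary.Core using (Rel)
open import Relation.Binary.Definitions using (Transitive; Trichotomous; Tri; tri<; tri≈; tri>)
open import Relation.Binary.PropositionalEquality
  using (_≡_; _≢_; refl; sym; cong; subst; subst₂; isEquivalence)
import Relation.Binary.PropositionalEquality as ≡
open import Relation.Binary.Structures using (IsStrictTotalOrder)
open import Relation.Binary.Structures.Biased using (isStrictTotalOrderᶜ)
import Relation.Binary.Construct.Flip.EqAndOrd as Flip
open import Relation.Nullary using (¬_; Dec; yes; no)
open import Relation.Nullary.Decidable using (does; _×-dec_; _⊎-dec_; _→-dec_; ¬?; dec-true; dec-false)
open import Relation.Unary using (Pred; Decidable; U)
open import Relation.Unary.Properties using (U?)

private
  variable
    a ℓ : Level
    A B : Set a
    m n : ℕ

module _ {_<_ : Rel A ℓ} (sto : IsStrictTotalOrder _≡_ _<_) where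
  open IsStrictTotalOrder sto using (compare; irrefl; asym; trans; _<?_)

  ≮∧≢⇒> : ∀ {x y} → ¬ x < y → x ≢ y → y < x
  ≮∧≢⇒> {x} {y} x≮y x≢y with compare x y
  ... | tri< x<y _ _ = ⊥-elim (x≮y x<y)
  ... | tri≈ _ x≡y _ = ⊥-elim (x≢y x≡y)
  ... | tri> _ _ y<x = y<x

  ≮-trans : ∀ {x y z} → ¬ x < y → ¬ y < z → ¬ x < z
  ≮-trans {x} {y} {z} x≮y y≮z x<z with compare x y
  ... | tri< x<y _ _ = x≮y x<y
  ... | tri≈ _ refl _ = y≮z x<z
  ... | tri> _ _ y<x = y≮z (trans y<x x<z)

  maximum : ∀ {p} (f : Fin n → A) {P : Pred (Fin n) p} → Decidable P →
            (∀ i → ¬ P i) ⊎ ∃[ i ] P i × (∀ j → P j → ¬ f i < f j)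
  maximum {n = zero} f P? = inj₁ λ ()
  maximum {n = suc n} f P? with maximum (f ∘ suc) (P? ∘ suc) | P? zero
  ... | inj₁ none | no ¬p₀ = inj₁ λ { zero → ¬p₀ ; (suc i) → none i }
  ... | inj₁ none | yes p₀ =
    inj₂ (zero , p₀ , λ { zero _ → irrefl refl ; (suc j) pⱼ → ⊥-elim (none j pⱼ) })
  ... | inj₂ (i , pᵢ , max) | no ¬p₀ =
    inj₂ (suc i , pᵢ , λ { zero p₀ → ⊥-elim (¬p₀ p₀) ; (suc j) pⱼ → max j pⱼ })
  ... | inj₂ (i , pᵢ , max) | yes p₀ with f zero <? f (suc i)
  ...   | yes f₀<fᵢ = inj₂ (suc i , pᵢ , λ { zero _ → asym f₀<fᵢ ; (suc j) pⱼ → max j pⱼ })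
  ...   | no f₀≮fᵢ =
    inj₂ (zero , p₀ , λ { zero _ → irrefl refl ; (suc j) pⱼ → ≮-trans f₀≮fᵢ (max j pⱼ) })

greatest : {_<_ : Rel (Fin (suc n)) ℓ} → IsStrictTotalOrder _≡_ _<_ →
           ∃[ v ] (∀ u → u ≢ v → u < v)
greatest sto with maximum sto id U?
... | inj₁ none = ⊥-elim (none zero tt)
... | inj₂ (v , _ , max) = v , λ u u≢v → ≮∧≢⇒> sto (max u tt) (u≢v ∘ sym)

on-injective-isStrictTotalOrder : {_<_ : Rel A ℓ} (f : B → A) → Injective _≡_ _≡_ f →
  IsStrictTotalOrder _≡_ _<_ → IsStrictTotalOrder _≡_ (_<_ on f)
on-injective-isStrictTotalOrder {_<_ = _<_} f f-inj sto = isStrictTotalOrderᶜ record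
  { isEquivalence = isEquivalence
  ; trans = IsStrictTotalOrder.trans sto
  ; compare = λ i j → compare′ (IsStrictTotalOrder.compare sto (f i) (f j))
  }
  where
  compare′ : ∀ {i j} → Tri (f i < f j) (f i ≡ f j) (f j < f i) → Tri (f i < f j) (i ≡ j) (f j < f i)
  compare′ (tri< lt ne gt) = tri< lt (ne ∘ cong f) gt
  compare′ (tri≈ lt eq gt) = tri≈ lt (f-inj eq) gt
  compare′ (tri> lt ne gt) = tri> lt (ne ∘ cong f) gt

module _ {_≺_ : Rel A ℓ} (sto : IsStrictTotalOrder _≡_ _≺_) {f : A → ℚ}
         (f-mono : ∀ {u w} → u ≺ w → f u < f w) where
  open IsStrictTotalOrder sto using (compare)

  strictMono⇒≺⇔< : ∀ {u w} → u ≺ w ⇔ f u < f w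
  strictMono⇒≺⇔< {u} {w} = mk⇔ f-mono reflect
    where
    reflect : f u < f w → u ≺ w
    reflect fu<fw with compare u w
    ... | tri< u<w _ _ = u<w
    ... | tri≈ _ refl _ = ⊥-elim (<-irrefl refl fu<fw)
    ... | tri> _ _ w<u = ⊥-elim (<-asym fu<fw (f-mono w<u))

  strictMono⇒injective : Injective _≡_ _≡_ f
  strictMono⇒injective {u} {w} fu≡fw with compare u w
  ... | tri< u<w _ _ = ⊥-elim (<-irrefl fu≡fw (f-mono u<w))
  ... | tri≈ _ u≡w _ = u≡w
  ... | tri> _ _ w<u = ⊥-elim (<-irrefl (sym fu≡fw) (f-mono w<u))

punchIn-elim : ∀ {p} (v : Fin (suc n)) {P : Pred (Fin (suc n)) p} →
               P v → (∀ i → P (punchIn v i)) → ∀ u → P u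
punchIn-elim v {P} pᵥ p-punchIn u with v Data.Fin.≟ u
... | yes refl = pᵥ
... | no v≢u = subst P (punchIn-punchOut v≢u) (p-punchIn (punchOut v≢u))

punchIn-elim₂ : ∀ {p} (v : Fin (suc n)) {P : Fin (suc n) → Fin (suc n) → Set p} →
                P v v → (∀ j → P v (punchIn v j)) → (∀ i → P (punchIn v i) v) →
                (∀ i j → P (punchIn v i) (punchIn v j)) → ∀ u w → P u w
punchIn-elim₂ v {P} pᵥᵥ pᵥⱼ pᵢᵥ pᵢⱼ u w =
  punchIn-elim v {λ u → P u w} (punchIn-elim v pᵥᵥ pᵥⱼ w) (λ i → punchIn-elim v (pᵢᵥ i) (pᵢⱼ i) w) u

p<p+1 : ∀ p → p < p + 1ℚ
p<p+1 p = subst (_< p + 1ℚ) (+-identityʳ p) (+-monoʳ-< p (positive⁻¹ 1ℚ))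

p-1<p : ∀ p → p - 1ℚ < p
p-1<p p = subst (p - 1ℚ <_) (+-identityʳ p) (+-monoʳ-< p (neg-antimono-< (positive⁻¹ 1ℚ)))

p-1+1≡p : ∀ p → p - 1ℚ + 1ℚ ≡ p
p-1+1≡p p = ≡.trans (+-assoc p (- 1ℚ) 1ℚ) (+-identityʳ p)

p+1-1≡p : ∀ p → p + 1ℚ - 1ℚ ≡ p
p+1-1≡p p = ≡.trans (+-assoc p 1ℚ (- 1ℚ)) (+-identityʳ p)

p-1<q⇒p<q+1 : ∀ {p q} → p - 1ℚ < q → p < q + 1ℚ
p-1<q⇒p<q+1 {p} {q} h = subst (_< q + 1ℚ) (p-1+1≡p p) (+-monoˡ-< 1ℚ h)

p<q+1⇒p-1<q : ∀ {p q} → p < q + 1ℚ → p - 1ℚ < q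
p<q+1⇒p-1<q {p} {q} h = subst (p - 1ℚ <_) (p+1-1≡p q) (+-monoˡ-< (- 1ℚ) h)

p+1<q⇒p<q-1 : ∀ {p q} → p + 1ℚ < q → p < q - 1ℚ
p+1<q⇒p<q-1 {p} {q} h = subst (_< q - 1ℚ) (p+1-1≡p p) (+-monoˡ-< (- 1ℚ) h)

p≤q⇒p-1<q+1 : ∀ {p q} → p ≤ q → p - 1ℚ < q + 1ℚ
p≤q⇒p-1<q+1 {p} {q} h = <-trans (p-1<p p) (≤-<-trans h (p<p+1 q))

room-above : ∀ {p} (l : ℚ) (hi : Fin n → ℚ) {P : Pred (Fin n) p} → Decidable P →
             (∀ j → P j → l < hi j) → ∃[ t ] l < t × (∀ j → P j → t < hi j)
room-above l hi P? l<hi with maximum (Flip.isStrictTotalOrder <-isStrictTotalOrder) hi P?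
... | inj₁ none = l + 1ℚ , p<p+1 l , λ j pⱼ → ⊥-elim (none j pⱼ)
... | inj₂ (m , pₘ , min) with <-dense (l<hi m pₘ)
...   | t , l<t , t<hiₘ = t , l<t , λ j pⱼ → <-≤-trans t<hiₘ (≮⇒≥ (min j pⱼ))

interpolate : ∀ {p} (lo hi : Fin n → ℚ) {P : Pred (Fin n) p} → Decidable P →
              (∀ i j → P j → lo i < hi j) → ∃[ t ] (∀ i → lo i < t) × (∀ j → P j → t < hi j)
interpolate lo hi P? lo<hi with maximum <-isStrictTotalOrder lo U?
... | inj₁ none =
  let t , _ , t<hi = room-above 0ℚ hi P? (λ j _ → ⊥-elim (none j tt)) in
  t , (λ i → ⊥-elim (none i tt)) , t<hi
... | inj₂ (m , _ , max) =
  let t , loₘ<t , t<hi = room-above (lo m) hi P? (lo<hi m) in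
  t , (λ i → ≤-<-trans (≮⇒≥ (max i tt)) loₘ<t) , t<hi

-- Crossings of two orders

Crossing : Rel A ℓ → Rel A ℓ → Rel A ℓ
Crossing _<₁_ _<₂_ u w = (u <₁ w × w <₂ u) ⊎ (u <₂ w × w <₁ u)

crossing-cong : ∀ {R₁ R₂ S₁ S₂ : Rel A ℓ} →
                (∀ {u w} → R₁ u w ⇔ S₁ u w) → (∀ {u w} → R₂ u w ⇔ S₂ u w) →
                ∀ {u w} → Crossing R₁ R₂ u w ⇔ Crossing S₁ S₂ u w
crossing-cong R₁⇔S₁ R₂⇔S₂ = (R₁⇔S₁ ×-⇔ R₂⇔S₂) ⊎-⇔ (R₂⇔S₂ ×-⇔ R₁⇔S₁)

module _ {_<₁_ _<₂_ : Rel A ℓ} (sto₁ : IsStrictTotalOrder _≡_ _<₁_) (sto₂ : IsStrictTotalOrder _≡_ _<₂_) where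

  crossing⇒≢ : ∀ {u w} → Crossing _<₁_ _<₂_ u w → u ≢ w
  crossing⇒≢ (inj₁ (u<w , _)) refl = IsStrictTotalOrder.irrefl sto₁ refl u<w
  crossing⇒≢ (inj₂ (_ , w<u)) refl = IsStrictTotalOrder.irrefl sto₁ refl w<u

  uncrossed-<₁⇒<₂ : ∀ {u w} → ¬ Crossing _<₁_ _<₂_ u w → u <₁ w → u <₂ w
  uncrossed-<₁⇒<₂ {u} {w} uncrossed u<₁w with IsStrictTotalOrder.compare sto₂ u w
  ... | tri< u<₂w _ _ = u<₂w
  ... | tri≈ _ refl _ = ⊥-elim (IsStrictTotalOrder.irrefl sto₁ refl u<₁w)
  ... | tri> _ _ w<₂u = ⊥-elim (uncrossed (inj₁ (u<₁w , w<₂u)))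

p<q⇒p-q<0 : ∀ {p q} → p < q → p - q < 0ℚ
p<q⇒p-q<0 {p} {q} h = subst (p - q <_) (+-inverseʳ q) (+-monoˡ-< (- q) h)

p>q⇒p-q>0 : ∀ {p q} → q < p → 0ℚ < p - q
p>q⇒p-q>0 {p} {q} h = subst (_< p - q) (+-inverseʳ q) (+-monoˡ-< (- q) h)

diff*diff<0⇔crossing : ∀ {a b c d} →
  (a - b) * (c - d) < 0ℚ ⇔ Crossing (_<_ on proj₁) (_<_ on proj₂) (a , c) (b , d)
diff*diff<0⇔crossing {a} {b} {c} {d} = mk⇔ to from
  where
  to : (a - b) * (c - d) < 0ℚ → Crossing (_<_ on proj₁) (_<_ on proj₂) (a , c) (b , d)
  to neg with <-cmp a b | <-cmp c d
  ... | tri< a<b _ _ | tri> _ _ d<c = inj₁ (a<b , d<c)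
  ... | tri> _ _ b<a | tri< c<d _ _ = inj₂ (c<d , b<a)
  ... | tri< a<b _ _ | tri< c<d _ _ = ⊥-elim (<-asym neg (positive⁻¹ _
          {{neg*neg⇒pos (a - b) {{negative (p<q⇒p-q<0 a<b)}} (c - d) {{negative (p<q⇒p-q<0 c<d)}}}}))
  ... | tri> _ _ b<a | tri> _ _ d<c = ⊥-elim (<-asym neg (positive⁻¹ _
          {{pos*pos⇒pos (a - b) {{positive (p>q⇒p-q>0 b<a)}} (c - d) {{positive (p>q⇒p-q>0 d<c)}}}}))
  ... | tri≈ _ refl _ | _ = ⊥-elim (<-irrefl (≡.trans (cong (_* (c - d)) (+-inverseʳ a)) (*-zeroˡ (c - d))) neg)
  ... | _ | tri≈ _ refl _ = ⊥-elim (<-irrefl (≡.trans (cong ((a - b) *_) (+-inverseʳ c)) (*-zeroʳ (a - b))) neg)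

  from : Crossing (_<_ on proj₁) (_<_ on proj₂) (a , c) (b , d) → (a - b) * (c - d) < 0ℚ
  from (inj₁ (a<b , d<c)) = negative⁻¹ _
    {{neg*pos⇒neg (a - b) {{negative (p<q⇒p-q<0 a<b)}} (c - d) {{positive (p>q⇒p-q>0 d<c)}}}}
  from (inj₂ (c<d , b<a)) = negative⁻¹ _
    {{pos*neg⇒neg (a - b) {{positive (p>q⇒p-q>0 b<a)}} (c - d) {{negative (p<q⇒p-q<0 c<d)}}}}

-- Placing the vertices for orders without backward edges

X≢Y : (inX : A → Bool) → ∀ {x y} → inX x ≡ true → inX y ≡ false → x ≢ y
X≢Y inX x∈X y∈Y refl = not-¬ x∈X y∈Y

record NormalOrders (n : ℕ) : Set₁ where
  field
    _<₁_ _<₂_ : Rel (Fin n) 0ℓ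
    <₁-isStrictTotalOrder : IsStrictTotalOrder _≡_ _<₁_
    <₂-isStrictTotalOrder : IsStrictTotalOrder _≡_ _<₂_
    inX : Fin n → Bool
    monochromatic-<₁⇒<₂ : ∀ {u w} → inX u ≡ inX w → u <₁ w → u <₂ w
    Y<₁X⇒Y<₂X : ∀ {x y} → inX x ≡ true → inX y ≡ false → y <₁ x → y <₂ x

  module <₁ = IsStrictTotalOrder <₁-isStrictTotalOrder
  module <₂ = IsStrictTotalOrder <₂-isStrictTotalOrder

restrict : (f : Fin m → Fin n) → Injective _≡_ _≡_ f → NormalOrders n → NormalOrders m
restrict f f-inj N = record
  { _<₁_ = _<₁_ on f
  ; _<₂_ = _<₂_ on f
  ; <₁-isStrictTotalOrder = on-injective-isStrictTotalOrder f f-inj <₁-isStrictTotalOrder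
  ; <₂-isStrictTotalOrder = on-injective-isStrictTotalOrder f f-inj <₂-isStrictTotalOrder
  ; inX = inX ∘ f
  ; monochromatic-<₁⇒<₂ = monochromatic-<₁⇒<₂
  ; Y<₁X⇒Y<₂X = Y<₁X⇒Y<₂X
  }
  where open NormalOrders N

shift : Bool → ℚ → ℚ
shift true  p = p + 1ℚ
shift false p = p - 1ℚ

shift≤p+1 : ∀ b p → shift b p ≤ p + 1ℚ
shift≤p+1 true  p = ≤-refl
shift≤p+1 false p = <⇒≤ (<-trans (p-1<p p) (p<p+1 p))

p≤shift+1 : ∀ b p → p ≤ shift b p + 1ℚ
p≤shift+1 true  p = <⇒≤ (<-trans (p<p+1 p) (p<p+1 (p + 1ℚ)))
p≤shift+1 false p = ≤-reflexive (sym (p-1+1≡p p))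

record Placement (N : NormalOrders n) : Set where
  open NormalOrders N
  field
    x₁ : Fin n → ℚ

  x₂ : Fin n → ℚ
  x₂ v = shift (inX v) (x₁ v)

  field
    x₁-mono : ∀ {u w} → u <₁ w → x₁ u < x₁ w
    x₂-mono : ∀ {u w} → u <₂ w → x₂ u < x₂ w
    X-close : ∀ {x x′} → inX x ≡ true → inX x′ ≡ true →
              (∀ {y} → inX y ≡ false → x <₂ y → x′ <₁ y) → x₁ x′ - 1ℚ < x₁ x + 1ℚ

  x₂-X : ∀ {v} → inX v ≡ true → x₂ v ≡ x₁ v + 1ℚ
  x₂-X {v} = cong (λ b → shift b (x₁ v))

  x₂-Y : ∀ {v} → inX v ≡ false → x₂ v ≡ x₁ v - 1ℚ
  x₂-Y {v} = cong (λ b → shift b (x₁ v))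

  x₁-injective : Injective _≡_ _≡_ x₁
  x₁-injective = strictMono⇒injective <₁-isStrictTotalOrder x₁-mono

  x₂-injective : Injective _≡_ _≡_ x₂
  x₂-injective = strictMono⇒injective <₂-isStrictTotalOrder x₂-mono

  crossing⇔diff*diff<0 : ∀ {u w} → Crossing _<₁_ _<₂_ u w ⇔ (x₁ u - x₁ w) * (x₂ u - x₂ w) < 0ℚ
  crossing⇔diff*diff<0 {u} {w} = ⇔-sym diff*diff<0⇔crossing ⇔-∘
    crossing-cong (strictMono⇒≺⇔< <₁-isStrictTotalOrder x₁-mono) (strictMono⇒≺⇔< <₂-isStrictTotalOrder x₂-mono) {u} {w}

module Extend (N : NormalOrders (suc n)) where
  open NormalOrders N

  v : Fin (suc n)
  v = proj₁ (greatest <₁-isStrictTotalOrder)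

  ι : Fin n → Fin (suc n)
  ι = punchIn v

  ι<₁v : ∀ i → ι i <₁ v
  ι<₁v i = proj₂ (greatest <₁-isStrictTotalOrder) (ι i) (punchInᵢ≢i v i)

  N′ : NormalOrders n
  N′ = restrict ι (punchIn-injective v _ _) N

  module _ (P′ : Placement N′) where
    open Placement P′ using ()
      renaming (x₁ to x₁′; x₂ to x₂′; x₁-mono to x₁′-mono; x₂-mono to x₂′-mono; X-close to X-close′;
                x₂-X to x₂′-X; x₂-Y to x₂′-Y)

    record Admissible (t : ℚ) : Set where
      field
        above-x₁ : ∀ i → x₁′ i < t
        above-x₂ : ∀ i → ι i <₂ v → x₂′ i < shift (inX v) t
        below-x₂ : ∀ i → v <₂ ι i → shift (inX v) t < x₂′ i
        X-close-v : inX v ≡ true → ∀ i → inX (ι i) ≡ true →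
                    (∀ j → inX (ι j) ≡ false → ¬ ι i <₂ ι j) → t - 1ℚ < x₁′ i + 1ℚ

    extend : ∀ t → Admissible t → Placement N
    extend t admissible = record { x₁ = x₁ ; x₁-mono = x₁-mono ; x₂-mono = x₂-mono ; X-close = X-close }
      where
      open Admissible admissible

      x₁ : Fin (suc n) → ℚ
      x₁ = insertAt x₁′ v t

      x₁-v : x₁ v ≡ t
      x₁-v = insertAt-lookup x₁′ v t

      x₁-ι : ∀ i → x₁ (ι i) ≡ x₁′ i
      x₁-ι i = insertAt-punchIn x₁′ v t i

      x₂ : Fin (suc n) → ℚ
      x₂ u = shift (inX u) (x₁ u)

      x₂-v : x₂ v ≡ shift (inX v) t
      x₂-v = cong (shift (inX v)) x₁-v

      x₂-ι : ∀ i → x₂ (ι i) ≡ x₂′ i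
      x₂-ι i = cong (shift (inX (ι i))) (x₁-ι i)

      x₁-mono : ∀ {u w} → u <₁ w → x₁ u < x₁ w
      x₁-mono {u} {w} = punchIn-elim₂ v {λ u w → u <₁ w → x₁ u < x₁ w}
        (λ v<v → ⊥-elim (<₁.irrefl refl v<v))
        (λ j v<ιj → ⊥-elim (<₁.asym v<ιj (ι<₁v j)))
        (λ i _ → subst₂ _<_ (sym (x₁-ι i)) (sym x₁-v) (above-x₁ i))
        (λ i j ιi<ιj → subst₂ _<_ (sym (x₁-ι i)) (sym (x₁-ι j)) (x₁′-mono ιi<ιj))
        u w

      x₂-mono : ∀ {u w} → u <₂ w → x₂ u < x₂ w
      x₂-mono {u} {w} = punchIn-elim₂ v {λ u w → u <₂ w → x₂ u < x₂ w}
        (λ v<v → ⊥-elim (<₂.irrefl refl v<v))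
        (λ j v<ιj → subst₂ _<_ (sym x₂-v) (sym (x₂-ι j)) (below-x₂ j v<ιj))
        (λ i ιi<v → subst₂ _<_ (sym (x₂-ι i)) (sym x₂-v) (above-x₂ i ιi<v))
        (λ i j ιi<ιj → subst₂ _<_ (sym (x₂-ι i)) (sym (x₂-ι j)) (x₂′-mono ιi<ιj))
        u w

      Close : Fin (suc n) → Fin (suc n) → Set
      Close x x′ = inX x ≡ true → inX x′ ≡ true →
                   (∀ {y} → inX y ≡ false → x <₂ y → x′ <₁ y) → x₁ x′ - 1ℚ < x₁ x + 1ℚ

      X-close : ∀ {x x′} → Close x x′
      X-close {x} {x′} = punchIn-elim₂ v {Close}
        (λ _ _ _ → p≤q⇒p-1<q+1 (≤-refl {x₁ v}))
        (λ j _ _ _ → subst₂ (λ p q → p - 1ℚ < q + 1ℚ) (sym (x₁-ι j)) (sym x₁-v)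
                       (p≤q⇒p-1<q+1 (<⇒≤ (above-x₁ j))))
        (λ i ιi∈X v∈X v-before → subst₂ (λ p q → p - 1ℚ < q + 1ℚ) (sym x₁-v) (sym (x₁-ι i))
                       (X-close-v v∈X i ιi∈X λ j ιj∈Y ιi<ιj → <₁.asym (ι<₁v j) (v-before ιj∈Y ιi<ιj)))
        (λ i j ιi∈X ιj∈X before → subst₂ (λ p q → p - 1ℚ < q + 1ℚ) (sym (x₁-ι j)) (sym (x₁-ι i))
                       (X-close′ ιi∈X ιj∈X before))
        x x′

    module _ (v∈X : inX v ≡ true) where
      ι<₂v : ∀ i → ι i <₂ v
      ι<₂v i with inX (ι i) in ιi∈?
      ... | true  = monochromatic-<₁⇒<₂ (≡.trans ιi∈? (sym v∈X)) (ι<₁v i)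
      ... | false = Y<₁X⇒Y<₂X v∈X ιi∈? (ι<₁v i)

      Free : Pred (Fin n) 0ℓ
      Free i = inX (ι i) ≡ true × (∀ j → inX (ι j) ≡ false → ¬ ι i <₂ ι j)

      Free? : Decidable Free
      Free? i = (inX (ι i) Bool.≟ true) ×-dec all? (λ j → (inX (ι j) Bool.≟ false) →-dec ¬? (ι i <₂.<? ι j))

      free-close : ∀ i {j} → Free j → x₁′ i - 1ℚ < x₁′ j + 1ℚ
      free-close i {j} (ιj∈X , no-Y-after) with inX (ι i) in ιi∈?
      ... | true  = X-close′ ιj∈X ιi∈? (λ ιy∈Y ιj<ιy → ⊥-elim (no-Y-after _ ιy∈Y ιj<ιy))
      ... | false = subst₂ _<_ (x₂′-Y ιi∈?) (x₂′-X ιj∈X)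
          (x₂′-mono (≮∧≢⇒> (NormalOrders.<₂-isStrictTotalOrder N′) (no-Y-after i ιi∈?) (X≢Y inX ιj∈X ιi∈? ∘ cong ι)))

      admissible-X : ∃ Admissible
      admissible-X with interpolate x₁′ (λ j → x₁′ j + 1ℚ + 1ℚ) Free? (λ i j free → p-1<q⇒p<q+1 (free-close i free))
      ... | t , x₁′<t , t<free = t , record
        { above-x₁ = x₁′<t
        ; above-x₂ = λ i _ → subst (x₂′ i <_) (cong (λ b → shift b t) (sym v∈X))
                               (≤-<-trans (shift≤p+1 (inX (ι i)) (x₁′ i)) (+-monoˡ-< 1ℚ (x₁′<t i)))
        ; below-x₂ = λ i v<ιi → ⊥-elim (<₂.asym v<ιi (ι<₂v i))
        ; X-close-v = λ _ i ιi∈X no-Y-after → p<q+1⇒p-1<q (t<free i (ιi∈X , no-Y-after))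
        }

    module _ (v∈Y : inX v ≡ false) where
      v<₂ι⇒X : ∀ {i} → v <₂ ι i → inX (ι i) ≡ true
      v<₂ι⇒X {i} v<ιi with inX (ι i) in ιi∈?
      ... | true  = refl
      ... | false = ⊥-elim (<₂.asym v<ιi (monochromatic-<₁⇒<₂ (≡.trans ιi∈? (sym v∈Y)) (ι<₁v i)))

      neighbours-close : ∀ {i j} → v <₂ ι i → v <₂ ι j → x₁′ i - 1ℚ < x₁′ j + 1ℚ
      neighbours-close {i} {j} v<ιi v<ιj = X-close′ (v<₂ι⇒X v<ιj) (v<₂ι⇒X v<ιi) λ {y} ιy∈Y ιj<ιy →
        ⊥-elim (<₂.asym (<₂.trans v<ιj ιj<ιy) (monochromatic-<₁⇒<₂ (≡.trans ιy∈Y (sym v∈Y)) (ι<₁v y)))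

      -- Vertices below v on line 2 must stay below it there; the others are X-neighbours
      -- of v and only have to stay below it on line 1.
      lower-bound : Fin n → ℚ
      lower-bound i with ι i <₂.<? v
      ... | yes _ = x₂′ i + 1ℚ
      ... | no  _ = x₁′ i

      lower<upper : ∀ i j → v <₂ ι j → lower-bound i < x₂′ j + 1ℚ
      lower<upper i j v<ιj with ι i <₂.<? v
      ... | yes ιi<v = +-monoˡ-< 1ℚ (x₂′-mono (<₂.trans ιi<v v<ιj))
      ... | no  ιi≮v = subst (x₁′ i <_) (cong (_+ 1ℚ) (sym (x₂′-X (v<₂ι⇒X v<ιj))))
          (p-1<q⇒p<q+1 (neighbours-close (≮∧≢⇒> <₂-isStrictTotalOrder ιi≮v (punchInᵢ≢i v i)) v<ιj))

      admissible-Y : ∃ Admissible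
      admissible-Y with interpolate lower-bound (λ j → x₂′ j + 1ℚ) (λ j → v <₂.<? ι j) lower<upper
      ... | t , lower<t , t<hi = t , record
        { above-x₁ = λ i → x₁′<t i (lower<t i)
        ; above-x₂ = λ i ιi<v → subst (x₂′ i <_) (sym shift-v) (x₂′<t-1 i ιi<v (lower<t i))
        ; below-x₂ = λ i v<ιi → subst (_< x₂′ i) (sym shift-v) (p<q+1⇒p-1<q (t<hi i v<ιi))
        ; X-close-v = λ v∈X → ⊥-elim (not-¬ v∈X v∈Y)
        }
        where
        shift-v : shift (inX v) t ≡ t - 1ℚ
        shift-v = cong (λ b → shift b t) v∈Y
        x₁′<t : ∀ i → lower-bound i < t → x₁′ i < t
        x₁′<t i lower<t with ι i <₂.<? v
        ... | yes _ = ≤-<-trans (p≤shift+1 (inX (ι i)) (x₁′ i)) lower<t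
        ... | no  _ = lower<t
        x₂′<t-1 : ∀ i → ι i <₂ v → lower-bound i < t → x₂′ i < t - 1ℚ
        x₂′<t-1 i ιi<v lower<t with ι i <₂.<? v
        ... | yes _    = p+1<q⇒p<q-1 lower<t
        ... | no ιi≮v = ⊥-elim (ιi≮v ιi<v)

    admissible : ∃ Admissible
    admissible with inX v in v∈?
    ... | true  = admissible-X v∈?
    ... | false = admissible-Y v∈?

  extension : Placement N′ → Placement N
  extension P′ = extend P′ (proj₁ (admissible P′)) (proj₂ (admissible P′))

placement : (N : NormalOrders n) → Placement N
placement {zero} N = record
  { x₁ = λ ()
  ; x₁-mono = λ { {()} }
  ; x₂-mono = λ { {()} }
  ; X-close = λ { {()} }
  }
placement {suc n} N = Extend.extension N (placement (Extend.N′ N))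

-- Removing the backward edges

splice : (A → Bool) → Rel A ℓ → Rel A ℓ → Rel A ℓ
splice flag _<ᵗ_ _<ᶠ_ u w = if flag u ∧ flag w then u <ᵗ w else u <ᶠ w

crossing-splice : ∀ (flag : A → Bool) {R₁ R₂ : Rel A ℓ} {u w} →
                  Crossing (splice flag R₂ R₁) (splice flag R₁ R₂) u w ⇔ Crossing R₁ R₂ u w
crossing-splice flag {u = u} {w} with flag u | flag w
... | true  | true  = mk⇔ Sum.swap Sum.swap
... | true  | false = mk⇔ id id
... | false | true  = mk⇔ id id
... | false | false = mk⇔ id id

module _ {_<ᵗ_ _<ᶠ_ : Rel A ℓ}
  (<ᵗ-isStrictTotalOrder : IsStrictTotalOrder _≡_ _<ᵗ_) (<ᶠ-isStrictTotalOrder : IsStrictTotalOrder _≡_ _<ᶠ_)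
  (flag : A → Bool) (uncrossed : ∀ {u w} → flag u ≢ flag w → ¬ Crossing _<ᶠ_ _<ᵗ_ u w) where

  private
    module <ᵗ = IsStrictTotalOrder <ᵗ-isStrictTotalOrder
    module <ᶠ = IsStrictTotalOrder <ᶠ-isStrictTotalOrder

    differ : ∀ {u w x} → flag u ≡ x → flag w ≡ not x → flag u ≢ flag w
    differ fu fw fu≡fw = not-¬ fu (≡.trans fu≡fw fw)

    ᶠ⇒ᵗ : ∀ {u w} → flag u ≢ flag w → u <ᶠ w → u <ᵗ w
    ᶠ⇒ᵗ f≢ = uncrossed-<₁⇒<₂ <ᶠ-isStrictTotalOrder <ᵗ-isStrictTotalOrder (uncrossed f≢)

    ᵗ⇒ᶠ : ∀ {u w} → flag u ≢ flag w → u <ᵗ w → u <ᶠ w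
    ᵗ⇒ᶠ f≢ = uncrossed-<₁⇒<₂ <ᵗ-isStrictTotalOrder <ᶠ-isStrictTotalOrder (uncrossed f≢ ∘ Sum.swap)

  splice-trans : Transitive (splice flag _<ᵗ_ _<ᶠ_)
  splice-trans {u} {w} {z} with flag u in fu | flag w in fw | flag z in fz
  ... | true  | true  | true  = <ᵗ.trans
  ... | true  | true  | false = λ r s → ᵗ⇒ᶠ (differ fu fz) (<ᵗ.trans r (ᶠ⇒ᵗ (differ fw fz) s))
  ... | true  | false | true  = λ r s → <ᵗ.trans (ᶠ⇒ᵗ (differ fu fw) r) (ᶠ⇒ᵗ (differ fw fz) s)
  ... | true  | false | false = <ᶠ.trans
  ... | false | true  | true  = λ r s → ᵗ⇒ᶠ (differ fu fz) (<ᵗ.trans (ᶠ⇒ᵗ (differ fu fw) r) s)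
  ... | false | true  | false = <ᶠ.trans
  ... | false | false | true  = <ᶠ.trans
  ... | false | false | false = <ᶠ.trans

  splice-compare : Trichotomous _≡_ (splice flag _<ᵗ_ _<ᶠ_)
  splice-compare u w with flag u | flag w
  ... | true  | true  = <ᵗ.compare u w
  ... | true  | false = <ᶠ.compare u w
  ... | false | true  = <ᶠ.compare u w
  ... | false | false = <ᶠ.compare u w

  splice-isStrictTotalOrder : IsStrictTotalOrder _≡_ (splice flag _<ᵗ_ _<ᶠ_)
  splice-isStrictTotalOrder = isStrictTotalOrderᶜ record
    { isEquivalence = isEquivalence
    ; trans = splice-trans
    ; compare = splice-compare
    }


module Normalise {_<₁_ _<₂_ : Rel (Fin n) 0ℓ}
  (<₁-isStrictTotalOrder : IsStrictTotalOrder _≡_ _<₁_) (<₂-isStrictTotalOrder : IsStrictTotalOrder _≡_ _<₂_)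
  (inX : Fin n → Bool) (crossing⇒bichromatic : ∀ {u w} → Crossing _<₁_ _<₂_ u w → inX u ≢ inX w) where

  private
    module <₁ = IsStrictTotalOrder <₁-isStrictTotalOrder
    module <₂ = IsStrictTotalOrder <₂-isStrictTotalOrder

  monochromatic-<₁⇒<₂ : ∀ {u w} → inX u ≡ inX w → u <₁ w → u <₂ w
  monochromatic-<₁⇒<₂ same = uncrossed-<₁⇒<₂ <₁-isStrictTotalOrder <₂-isStrictTotalOrder
    (λ crossing → crossing⇒bichromatic crossing same)

  monochromatic-<₂⇒<₁ : ∀ {u w} → inX u ≡ inX w → u <₂ w → u <₁ w
  monochromatic-<₂⇒<₁ same = uncrossed-<₁⇒<₂ <₂-isStrictTotalOrder <₁-isStrictTotalOrder
    (λ crossing → crossing⇒bichromatic (Sum.swap crossing) same)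

  Backward Forward : Fin n → Fin n → Set
  Backward x y = inX x ≡ true × inX y ≡ false × y <₁ x × x <₂ y
  Forward  x y = inX x ≡ true × inX y ≡ false × x <₁ y × y <₂ x

  OnBackward OnForward : Fin n → Set
  OnBackward v = ∃[ w ] (Backward v w ⊎ Backward w v)
  OnForward  v = ∃[ w ] (Forward v w ⊎ Forward w v)

  crossing-orientation : ∀ {u w} → Crossing _<₁_ _<₂_ u w →
    (OnBackward u × OnBackward w) ⊎ (OnForward u × OnForward w)
  crossing-orientation {u} {w} = orient (inX u) (inX w) refl refl
    where
    orient : ∀ b b′ → inX u ≡ b → inX w ≡ b′ → Crossing _<₁_ _<₂_ u w →
             (OnBackward u × OnBackward w) ⊎ (OnForward u × OnForward w)
    orient true  true  u? w? crossing = ⊥-elim (crossing⇒bichromatic crossing (≡.trans u? (sym w?)))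
    orient false false u? w? crossing = ⊥-elim (crossing⇒bichromatic crossing (≡.trans u? (sym w?)))
    orient true  false u? w? (inj₁ (u<₁w , w<₂u)) =
      inj₂ ((w , inj₁ (u? , w? , u<₁w , w<₂u)) , (u , inj₂ (u? , w? , u<₁w , w<₂u)))
    orient true  false u? w? (inj₂ (u<₂w , w<₁u)) =
      inj₁ ((w , inj₁ (u? , w? , w<₁u , u<₂w)) , (u , inj₂ (u? , w? , w<₁u , u<₂w)))
    orient false true  u? w? (inj₁ (u<₁w , w<₂u)) =
      inj₁ ((w , inj₂ (w? , u? , u<₁w , w<₂u)) , (u , inj₁ (w? , u? , u<₁w , w<₂u)))
    orient false true  u? w? (inj₂ (u<₂w , w<₁u)) =
      inj₂ ((w , inj₂ (w? , u? , w<₁u , u<₂w)) , (u , inj₁ (w? , u? , w<₁u , u<₂w)))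

  forward⇒¬backward : ∀ {v} → OnForward v → ¬ OnBackward v
  forward⇒¬backward (_ , inj₁ (_ , y′∈Y , v<₁y′ , y′<₂v)) (_ , inj₁ (_ , y∈Y , y<₁v , v<₂y)) =
    <₂.asym (monochromatic-<₁⇒<₂ (≡.trans y∈Y (sym y′∈Y)) (<₁.trans y<₁v v<₁y′)) (<₂.trans y′<₂v v<₂y)
  forward⇒¬backward (_ , inj₂ (x′∈X , _ , x′<₁v , v<₂x′)) (_ , inj₂ (x∈X , _ , v<₁x , x<₂v)) =
    <₂.asym (monochromatic-<₁⇒<₂ (≡.trans x′∈X (sym x∈X)) (<₁.trans x′<₁v v<₁x)) (<₂.trans x<₂v v<₂x′)
  forward⇒¬backward (_ , inj₁ (v∈X , _)) (_ , inj₂ (_ , v∈Y , _)) = not-¬ v∈X v∈Y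
  forward⇒¬backward (_ , inj₂ (_ , v∈Y , _)) (_ , inj₁ (v∈X , _)) = not-¬ v∈X v∈Y

  onBackward? : Decidable OnBackward
  onBackward? v = any? λ w → backward? v w ⊎-dec backward? w v
    where
    backward? : ∀ x y → Dec (Backward x y)
    backward? x y = (inX x Bool.≟ true) ×-dec (inX y Bool.≟ false) ×-dec (y <₁.<? x) ×-dec (x <₂.<? y)

  flipped : Fin n → Bool
  flipped v = does (onBackward? v)

  flipped⇒onBackward : ∀ {v} → flipped v ≡ true → OnBackward v
  flipped⇒onBackward {v} with onBackward? v
  ... | yes onBackward = λ _ → onBackward
  ... | no  _          = λ ()

  unflipped⇒¬onBackward : ∀ {v} → flipped v ≡ false → ¬ OnBackward v
  unflipped⇒¬onBackward {v} with onBackward? v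
  ... | yes _           = λ ()
  ... | no ¬onBackward  = λ _ → ¬onBackward

  crossing⇒same-flip : ∀ {u w} → Crossing _<₁_ _<₂_ u w → flipped u ≡ flipped w
  crossing⇒same-flip crossing with crossing-orientation crossing
  ... | inj₁ (backward-u , backward-w) =
    ≡.trans (dec-true (onBackward? _) backward-u) (sym (dec-true (onBackward? _) backward-w))
  ... | inj₂ (forward-u , forward-w) =
    ≡.trans (dec-false (onBackward? _) (forward⇒¬backward forward-u))
            (sym (dec-false (onBackward? _) (forward⇒¬backward forward-w)))

  _<₁′_ _<₂′_ : Rel (Fin n) 0ℓ
  _<₁′_ = splice flipped _<₂_ _<₁_
  _<₂′_ = splice flipped _<₁_ _<₂_

  differently-flipped⇒uncrossed : ∀ {u w} → flipped u ≢ flipped w → ¬ Crossing _<₁_ _<₂_ u w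
  differently-flipped⇒uncrossed flips-differ = flips-differ ∘ crossing⇒same-flip

  monochromatic-<₁′⇒<₂′ : ∀ {u w} → inX u ≡ inX w → u <₁′ w → u <₂′ w
  monochromatic-<₁′⇒<₂′ {u} {w} same with flipped u | flipped w
  ... | true  | true  = monochromatic-<₂⇒<₁ same
  ... | true  | false = monochromatic-<₁⇒<₂ same
  ... | false | _     = monochromatic-<₁⇒<₂ same

  unflipped-Y<₁X⇒Y<₂X : ∀ {x y} → inX x ≡ true → inX y ≡ false →
                        ¬ OnBackward x ⊎ ¬ OnBackward y → y <₁ x → y <₂ x
  unflipped-Y<₁X⇒Y<₂X {x} {y} x∈X y∈Y unflipped y<₁x = ≮∧≢⇒> <₂-isStrictTotalOrder
    (λ x<₂y → Sum.[ (λ ¬bₓ → ¬bₓ (y , inj₁ (x∈X , y∈Y , y<₁x , x<₂y))) ,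
                    (λ ¬bᵧ → ¬bᵧ (x , inj₂ (x∈X , y∈Y , y<₁x , x<₂y))) ] unflipped)
    (X≢Y inX x∈X y∈Y)

  Y<₁′X⇒Y<₂′X : ∀ {x y} → inX x ≡ true → inX y ≡ false → y <₁′ x → y <₂′ x
  Y<₁′X⇒Y<₂′X {x} {y} x∈X y∈Y with flipped y in fy | flipped x in fx
  ... | true  | true  = λ y<₂x → ≮∧≢⇒> <₁-isStrictTotalOrder
          (λ x<₁y → forward⇒¬backward (y , inj₁ (x∈X , y∈Y , x<₁y , y<₂x)) (flipped⇒onBackward fx))
          (X≢Y inX x∈X y∈Y)
  ... | true  | false = unflipped-Y<₁X⇒Y<₂X x∈X y∈Y (inj₁ (unflipped⇒¬onBackward fx))
  ... | false | _     = unflipped-Y<₁X⇒Y<₂X x∈X y∈Y (inj₂ (unflipped⇒¬onBackward fy))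

  normal : NormalOrders n
  normal = record
    { _<₁_ = _<₁′_
    ; _<₂_ = _<₂′_
    ; <₁-isStrictTotalOrder = splice-isStrictTotalOrder <₂-isStrictTotalOrder <₁-isStrictTotalOrder flipped
        differently-flipped⇒uncrossed
    ; <₂-isStrictTotalOrder = splice-isStrictTotalOrder <₁-isStrictTotalOrder <₂-isStrictTotalOrder flipped
        (λ flips-differ → differently-flipped⇒uncrossed flips-differ ∘ Sum.swap)
    ; inX = inX
    ; monochromatic-<₁⇒<₂ = monochromatic-<₁′⇒<₂′
    ; Y<₁X⇒Y<₂X = Y<₁′X⇒Y<₂′X
    }

  crossing-normal : ∀ {u w} → Crossing _<₁′_ _<₂′_ u w ⇔ Crossing _<₁_ _<₂_ u w
  crossing-normal = crossing-splice flipped {_<₁_} {_<₂_}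

lemma2p11 : ∀ {n} (G : Graph n) (inX : Fin n → Bool) →
    IsBipartition G inX → IsPermutationGraph G →
    Σ (Fin n → ℚ) λ x₁ → Σ (Fin n → ℚ) λ x₂ →
      IsPermutationDiagram G x₁ x₂ ×
      (∀ v → inX v ≡ true → x₂ v ≡ x₁ v + 1ℚ) ×
      (∀ v → inX v ≡ false → x₂ v ≡ x₁ v - 1ℚ)
lemma2p11 G inX bipartite (_<₁_ , _<₂_ , <₁-sto , <₂-sto , adj⇔crossing) =
  x₁ , x₂ , (x₁-injective , x₂-injective , represents) , (λ _ → x₂-X) , (λ _ → x₂-Y)
  where
  crossing⇒bichromatic : ∀ {u w} → Crossing _<₁_ _<₂_ u w → inX u ≢ inX w
  crossing⇒bichromatic crossing = bipartite _ _
    (Equivalence.from (adj⇔crossing _ _ (crossing⇒≢ <₁-sto <₂-sto crossing)) crossing)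

  open Normalise <₁-sto <₂-sto inX crossing⇒bichromatic using (normal; crossing-normal)
  open Placement (placement normal)

  represents : ∀ u w → u ≢ w → Adj G u w ⇔ ((x₁ u - x₁ w) * (x₂ u - x₂ w) < 0ℚ)
  represents u w u≢w = crossing⇔diff*diff<0 ⇔-∘ (⇔-sym crossing-normal ⇔-∘ adj⇔crossing u w u≢w)
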